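{- Let $n$ be a positive integer at least $5$. Then $S_{n-1}$ is a perfect code of $(S_{n},S_{3})$.
   Context: $S_n$ is the symmetric group on $\{1,\ldots,n\}$, and for $m<n$, $S_m$ is regarded as the subgroup of $S_n$ fixing every point of $\{m+1,\ldots,n\}$. For a finite group $G$, a subgroup $H\leq G$ and a subset $U\subseteq G$ which is a union of double cosets of $H$ with $H\cap U=\emptyset$ and $U^{ -1}=U$, the coset graph $\mathrm{Cos}(G,H,U)$ has as vertex set the set of left cosets of $H$ in $G$, with $g_1H$ and $g_2H$ adjacent iff $g_1^{ -1}g_2\in U$. A perfect code in a graph is an independent set $C$ of vertices such that every vertex outside $C$ is adjacent to exactly one vertex of $C$. For $H\leq A\leq G$, $A$ is called a perfect code of the pair $(G,H)$ if there is a coset graph $\mathrm{Cos}(G,H,U)$ in which the set $\{aH: a\in A\}$ of left cosets of $H$ contained in $A$ is a perfect code. -}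

module Defs where

open import Level using (0ℓ)
open import Data.Nat using (ℕ; _≤_)
open import Data.Fin using (Fin; toℕ)
open import Data.Fin.Permutation using (Permutation′; _⟨$⟩ʳ_; _∘ₚ_; flip; _≈_)
open import Data.Product using (Σ; ∃; _×_)
open import Relation.Unary using (Pred)
open import Relation.Nullary using (¬_)
open import Relation.Binary.PropositionalEquality using (_≡_)

-- The symmetric group S_n: permutations of Fin n (= {1,…,n} shifted to {0,…,n-1}),
-- with equality _≈_ = pointwise equality of the underlying functions.
Perm : ℕ → Set
Perm n = Permutation′ n

-- Group product g · h = "first h, then g" (usual composition of functions),
-- and group inverse.
infixl 7 _·_
_·_ : ∀ {n} → Perm n → Perm n → Perm n
g · h = h ∘ₚ g

inv : ∀ {n} → Perm n → Perm n
inv = flip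

Subset : ℕ → Set₁
Subset n = Pred (Perm n) 0ℓ

-- S_m ≤ S_n : permutations fixing every point of {m+1,…,n},
-- i.e. (0-indexed) every i with m ≤ toℕ i.
Sym : (n m : ℕ) → Subset n
Sym n m π = ∀ (i : Fin n) → m ≤ toℕ i → π ⟨$⟩ʳ i ≡ i

module _ {n : ℕ} (H : Subset n) where

  -- Vertices of Cos(S_n,H,U) are left cosets gH, represented by g;
  -- g₁ and g₂ represent the same vertex iff g₁⁻¹ g₂ ∈ H.
  SameCoset : Perm n → Perm n → Set
  SameCoset g₁ g₂ = H (inv g₁ · g₂)

  record IsConnectionSet (U : Subset n) : Set where
    field
      respects    : ∀ g g′ → g ≈ g′ → U g → U g′
      doubleCoset : ∀ h u h′ → H h → U u → H h′ → U (h · u · h′)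
      disjoint    : ∀ g → H g → ¬ U g
      symmetric   : ∀ u → U u → U (inv u)

  Adj : Subset n → Perm n → Perm n → Set
  Adj U g₁ g₂ = U (inv g₁ · g₂)

  record IsPerfectCode (U : Subset n) (C : Subset n) : Set where
    field
      independent : ∀ c c′ → C c → C c′ → ¬ Adj U c c′
      dominating  : ∀ g → ¬ C g → ∃ λ c → C c × Adj U g c
      unique      : ∀ g c c′ → ¬ C g → C c → C c′ → Adj U g c → Adj U g c′
                    → SameCoset c c′

  -- The vertex set {aH : a ∈ A}: gH belongs to it iff gH = aH for some a ∈ A.
  CosetsIn : Subset n → Subset n
  CosetsIn A g = ∃ λ a → A a × SameCoset g a

  IsPerfectCodeOfPair : Subset n → Set₁
  IsPerfectCodeOfPair A =
    (∀ h → H h → A h) ×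
    Σ (Subset n) λ U → IsConnectionSet U × IsPerfectCode U (CosetsIn A)

-- Let H fix every point of a set F containing p, and let A be the stabiliser
-- of p. Take the connection set U to be the permutations σ that move p and
-- agree on F with the transposition (p σ(p)); U is inverse-closed and a union
-- of H-double cosets because H fixes p and permutes the complement of F.
-- A coset gH lies in A iff g fixes p. If g does not, c = g (g⁻¹(p) p) fixes p
-- and g⁻¹c ∈ U; and any two such c, c′ make g⁻¹c, g⁻¹c′ agree on F, that is,
-- c⁻¹c′ ∈ H.
module Submission where

open import Defs
open import Level using (0ℓ)
open import Data.Nat using (ℕ; suc; s≤s; _≤_; _∸_)
open import Data.Nat.Properties using (≤-trans; ≤-reflexive; ≤-antisym; ≤-pred; n≤1+n; _≤?_)
open import Data.Fin using (Fin; toℕ; fromℕ; _≟_)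
open import Data.Fin.Properties using (toℕ<n; toℕ-fromℕ; toℕ-injective)
open import Data.Fin.Permutation
  using (_⟨$⟩ʳ_; _⟨$⟩ˡ_; inverseˡ; inverseʳ; transpose)
  renaming (_≈_ to _≈ₚ_)
import Data.Fin.Permutation.Components as PC
open import Data.Product using (∃; _×_; _,_)
open import Data.Sum using (_⊎_; inj₁; inj₂)
open import Function using (_⇔_; mk⇔; module Equivalence)
open import Relation.Nullary using (¬_; yes; no; contradiction)
open import Relation.Nullary.Decidable using (dec-true; dec-false)
open import Relation.Unary using (Pred; Decidable)
open import Relation.Binary.PropositionalEquality
  using (_≡_; _≢_; refl; sym; trans; cong; subst; module ≡-Reasoning)

open ≡-Reasoning
open Equivalence using (to; from)

transpose-matchˡ : ∀ {n} (i j : Fin n) → PC.transpose i j i ≡ j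
transpose-matchˡ i j rewrite dec-true (i ≟ i) refl = refl

transpose-matchʳ : ∀ {n} (i j : Fin n) → PC.transpose i j j ≡ i
transpose-matchʳ i j with j ≟ i
... | yes j≡i = j≡i
... | no _ rewrite dec-true (j ≟ j) refl = refl

transpose-fixes : ∀ {n} {i j k : Fin n} → k ≢ i → k ≢ j → PC.transpose i j k ≡ k
transpose-fixes {i = i} {j} {k} k≢i k≢j
  rewrite dec-false (k ≟ i) k≢i | dec-false (k ≟ j) k≢j = refl

⟨$⟩ʳ-injective : ∀ {n} (π : Perm n) {x y : Fin n} → π ⟨$⟩ʳ x ≡ π ⟨$⟩ʳ y → x ≡ y
⟨$⟩ʳ-injective π {x} {y} πx≡πy = begin
  x                    ≡⟨ sym (inverseˡ π) ⟩
  π ⟨$⟩ˡ (π ⟨$⟩ʳ x)    ≡⟨ cong (π ⟨$⟩ˡ_) πx≡πy ⟩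
  π ⟨$⟩ˡ (π ⟨$⟩ʳ y)    ≡⟨ inverseˡ π ⟩
  y                    ∎

⟨$⟩ˡ-fixed : ∀ {n} (π : Perm n) {x : Fin n} → π ⟨$⟩ʳ x ≡ x → π ⟨$⟩ˡ x ≡ x
⟨$⟩ˡ-fixed π {x} πx≡x = ⟨$⟩ʳ-injective π (trans (inverseʳ π) (sym πx≡x))

FixesAll : ∀ {n} → Pred (Fin n) 0ℓ → Subset n
FixesAll F π = ∀ i → F i → π ⟨$⟩ʳ i ≡ i

Fixes : ∀ {n} → Fin n → Subset n
Fixes p π = π ⟨$⟩ʳ p ≡ p

fixesAll-fixed⊎outside : ∀ {n} {F : Pred (Fin n) 0ℓ} → Decidable F →
                         ∀ h → FixesAll F h → ∀ y → h ⟨$⟩ʳ y ≡ y ⊎ ¬ F (h ⟨$⟩ʳ y)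
fixesAll-fixed⊎outside F? h hF y with F? (h ⟨$⟩ʳ y)
... | yes F-hy = inj₁ (⟨$⟩ʳ-injective h (hF _ F-hy))
... | no ¬F-hy = inj₂ ¬F-hy

Sym-last⇔Fixes : ∀ m (g : Perm (suc m)) → Sym (suc m) m g ⇔ Fixes (fromℕ m) g
Sym-last⇔Fixes m g = mk⇔
  (λ gSym → gSym (fromℕ m) (≤-reflexive (sym (toℕ-fromℕ m))))
  (λ gp≡p i m≤i → subst (λ j → g ⟨$⟩ʳ j ≡ j) (sym (is-last i m≤i)) gp≡p)
  where
  is-last : ∀ i → m ≤ toℕ i → i ≡ fromℕ m
  is-last i m≤i = toℕ-injective
    (trans (≤-antisym (≤-pred (toℕ<n i)) m≤i) (sym (toℕ-fromℕ m)))

-- With F = {4,…,n} and p = n, H is S_3 and the stabiliser of p is S_{n-1}.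
module StabilizerOfPoint {N : ℕ} {F : Pred (Fin N) 0ℓ} (F? : Decidable F)
                         {p : Fin N} (Fp : F p) where

  H : Subset N
  H = FixesAll F

  record Connection (σ : Perm N) : Set where
    field
      moves        : σ ⟨$⟩ʳ p ≢ p
      fixes-others : ∀ k → F k → k ≢ p → k ≢ σ ⟨$⟩ʳ p → σ ⟨$⟩ʳ k ≡ k
      swaps-back   : F (σ ⟨$⟩ʳ p) → σ ⟨$⟩ʳ (σ ⟨$⟩ʳ p) ≡ p
  open Connection

  Connection-resp-≈ : ∀ g g′ → g ≈ₚ g′ → Connection g → Connection g′
  Connection-resp-≈ g g′ g≈g′ g-conn = record
    { moves        = λ g′p≡p → moves g-conn (trans (g≈g′ p) g′p≡p)
    ; fixes-others = λ k Fk k≢p k≢g′p →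
        trans (sym (g≈g′ k)) (fixes-others g-conn k Fk k≢p (λ k≡gp → k≢g′p (trans k≡gp (g≈g′ p))))
    ; swaps-back   = λ F-g′p → begin
        g′ ⟨$⟩ʳ (g′ ⟨$⟩ʳ p)  ≡⟨ cong (g′ ⟨$⟩ʳ_) (sym (g≈g′ p)) ⟩
        g′ ⟨$⟩ʳ (g ⟨$⟩ʳ p)   ≡⟨ sym (g≈g′ _) ⟩
        g ⟨$⟩ʳ (g ⟨$⟩ʳ p)    ≡⟨ swaps-back g-conn (subst F (sym (g≈g′ p)) F-g′p) ⟩
        p                    ∎
    }

  Connection-doubleCoset : ∀ h u h′ → H h → Connection u → H h′ → Connection (h · u · h′)
  Connection-doubleCoset h u h′ hH u-conn h′H =
    record { moves = v-moves ; fixes-others = v-fixes-others ; swaps-back = v-swaps-back }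
    where
    v : Perm N
    v = h · u · h′

    v-on-F : ∀ k → F k → v ⟨$⟩ʳ k ≡ h ⟨$⟩ʳ (u ⟨$⟩ʳ k)
    v-on-F k Fk = cong (λ z → h ⟨$⟩ʳ (u ⟨$⟩ʳ z)) (h′H k Fk)

    vp≡hup : v ⟨$⟩ʳ p ≡ h ⟨$⟩ʳ (u ⟨$⟩ʳ p)
    vp≡hup = v-on-F p Fp

    v-moves : v ⟨$⟩ʳ p ≢ p
    v-moves vp≡p with fixesAll-fixed⊎outside F? h hH (u ⟨$⟩ʳ p)
    ... | inj₁ hup≡up = moves u-conn (trans (sym hup≡up) (trans (sym vp≡hup) vp≡p))
    ... | inj₂ ¬F-hup = ¬F-hup (subst F (trans (sym vp≡p) vp≡hup) Fp)

    v-fixes-others : ∀ k → F k → k ≢ p → k ≢ v ⟨$⟩ʳ p → v ⟨$⟩ʳ k ≡ k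
    v-fixes-others k Fk k≢p k≢vp = begin
      v ⟨$⟩ʳ k               ≡⟨ v-on-F k Fk ⟩
      h ⟨$⟩ʳ (u ⟨$⟩ʳ k)      ≡⟨ cong (h ⟨$⟩ʳ_) (fixes-others u-conn k Fk k≢p k≢up) ⟩
      h ⟨$⟩ʳ k               ≡⟨ hH k Fk ⟩
      k                      ∎
      where
      k≢up : k ≢ u ⟨$⟩ʳ p
      k≢up k≡up = k≢vp (trans (sym (hH k Fk)) (trans (cong (h ⟨$⟩ʳ_) k≡up) (sym vp≡hup)))

    v-swaps-back : F (v ⟨$⟩ʳ p) → v ⟨$⟩ʳ (v ⟨$⟩ʳ p) ≡ p
    v-swaps-back F-vp with fixesAll-fixed⊎outside F? h hH (u ⟨$⟩ʳ p)
    ... | inj₂ ¬F-hup = contradiction (subst F vp≡hup F-vp) ¬F-hup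
    ... | inj₁ hup≡up = begin
      v ⟨$⟩ʳ (v ⟨$⟩ʳ p)            ≡⟨ cong (v ⟨$⟩ʳ_) vp≡up ⟩
      v ⟨$⟩ʳ (u ⟨$⟩ʳ p)            ≡⟨ v-on-F _ F-up ⟩
      h ⟨$⟩ʳ (u ⟨$⟩ʳ (u ⟨$⟩ʳ p))   ≡⟨ cong (h ⟨$⟩ʳ_) (swaps-back u-conn F-up) ⟩
      h ⟨$⟩ʳ p                     ≡⟨ hH p Fp ⟩
      p                            ∎
      where
      vp≡up : v ⟨$⟩ʳ p ≡ u ⟨$⟩ʳ p
      vp≡up = trans vp≡hup hup≡up
      F-up : F (u ⟨$⟩ʳ p)
      F-up = subst F vp≡up F-vp

  Connection-inv : ∀ u → Connection u → Connection (inv u)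
  Connection-inv u u-conn =
    record { moves = u⁻¹-moves ; fixes-others = u⁻¹-fixes-others ; swaps-back = u⁻¹-swaps-back }
    where
    u⁻¹-moves : u ⟨$⟩ˡ p ≢ p
    u⁻¹-moves u⁻¹p≡p = moves u-conn (trans (cong (u ⟨$⟩ʳ_) (sym u⁻¹p≡p)) (inverseʳ u))

    u⁻¹p≡up : F (u ⟨$⟩ˡ p) → u ⟨$⟩ˡ p ≡ u ⟨$⟩ʳ p
    u⁻¹p≡up F-u⁻¹p with u ⟨$⟩ˡ p ≟ u ⟨$⟩ʳ p
    ... | yes eq = eq
    ... | no neq = contradiction
      (trans (sym (fixes-others u-conn _ F-u⁻¹p u⁻¹-moves neq)) (inverseʳ u)) u⁻¹-moves

    u⁻¹-fixes-others : ∀ k → F k → k ≢ p → k ≢ u ⟨$⟩ˡ p → u ⟨$⟩ˡ k ≡ k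
    u⁻¹-fixes-others k Fk k≢p k≢u⁻¹p = ⟨$⟩ˡ-fixed u (fixes-others u-conn k Fk k≢p k≢up)
      where
      k≢up : k ≢ u ⟨$⟩ʳ p
      k≢up k≡up = k≢u⁻¹p (begin
        k                          ≡⟨ k≡up ⟩
        u ⟨$⟩ʳ p                   ≡⟨ sym (inverseˡ u) ⟩
        u ⟨$⟩ˡ (u ⟨$⟩ʳ (u ⟨$⟩ʳ p))  ≡⟨ cong (u ⟨$⟩ˡ_) (swaps-back u-conn (subst F k≡up Fk)) ⟩
        u ⟨$⟩ˡ p                   ∎)

    u⁻¹-swaps-back : F (u ⟨$⟩ˡ p) → u ⟨$⟩ˡ (u ⟨$⟩ˡ p) ≡ p
    u⁻¹-swaps-back F-u⁻¹p = trans (cong (u ⟨$⟩ˡ_) (u⁻¹p≡up F-u⁻¹p)) (inverseˡ u)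

  Connection-disjoint : ∀ g → H g → ¬ Connection g
  Connection-disjoint g gH g-conn = moves g-conn (gH p Fp)

  Connection-isConnectionSet : IsConnectionSet H Connection
  Connection-isConnectionSet = record
    { respects    = Connection-resp-≈
    ; doubleCoset = Connection-doubleCoset
    ; disjoint    = Connection-disjoint
    ; symmetric   = Connection-inv
    }

  Connection-determined-at-p : ∀ u u′ → Connection u → Connection u′ →
                               u ⟨$⟩ʳ p ≡ u′ ⟨$⟩ʳ p → ∀ i → F i → u ⟨$⟩ʳ i ≡ u′ ⟨$⟩ʳ i
  Connection-determined-at-p u u′ u-conn u′-conn up≡u′p i Fi with i ≟ p
  ... | yes refl = up≡u′p
  ... | no i≢p with i ≟ u ⟨$⟩ʳ p
  ...   | yes refl = trans (swaps-back u-conn Fi)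
                       (sym (trans (cong (u′ ⟨$⟩ʳ_) up≡u′p) (swaps-back u′-conn (subst F up≡u′p Fi))))
  ...   | no i≢up = trans (fixes-others u-conn i Fi i≢p i≢up)
                      (sym (fixes-others u′-conn i Fi i≢p (λ i≡u′p → i≢up (trans i≡u′p (sym up≡u′p)))))

  transpose-connection : ∀ q → q ≢ p → Connection (transpose q p)
  transpose-connection q q≢p = record
    { moves        = λ τp≡p → q≢p (trans (sym τp≡q) τp≡p)
    ; fixes-others = λ k _ k≢p k≢τp → transpose-fixes (λ k≡q → k≢τp (trans k≡q (sym τp≡q))) k≢p
    ; swaps-back   = λ _ → trans (cong (transpose q p ⟨$⟩ʳ_) τp≡q) (transpose-matchˡ q p)
    }
    where
    τp≡q : transpose q p ⟨$⟩ʳ p ≡ q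
    τp≡q = transpose-matchʳ q p

  module _ (A : Subset N) (A⇔Fixes : ∀ g → A g ⇔ Fixes p g) where

    C : Subset N
    C = CosetsIn H A

    cosetsIn⇔fixes : ∀ g → C g ⇔ Fixes p g
    cosetsIn⇔fixes g = mk⇔
      (λ { (a , Aa , g⁻¹a∈H) → ⟨$⟩ˡ-fixed (inv g)
             (trans (cong (g ⟨$⟩ˡ_) (sym (to (A⇔Fixes a) Aa))) (g⁻¹a∈H p Fp)) })
      (λ gp≡p → g , from (A⇔Fixes g) gp≡p , λ _ _ → inverseˡ g)

    C-independent : ∀ c c′ → C c → C c′ → ¬ Adj H Connection c c′
    C-independent c c′ c∈C c′∈C c⁻¹c′-conn = moves c⁻¹c′-conn (begin
      c ⟨$⟩ˡ (c′ ⟨$⟩ʳ p)  ≡⟨ cong (c ⟨$⟩ˡ_) (to (cosetsIn⇔fixes c′) c′∈C) ⟩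
      c ⟨$⟩ˡ p            ≡⟨ ⟨$⟩ˡ-fixed c (to (cosetsIn⇔fixes c) c∈C) ⟩
      p                   ∎)

    C-dominating : ∀ g → ¬ C g → ∃ λ c → C c × Adj H Connection g c
    C-dominating g g∉C =
      g · τ , from (cosetsIn⇔fixes (g · τ)) gτp≡p ,
      Connection-resp-≈ τ (inv g · (g · τ)) (λ _ → sym (inverseˡ g)) (transpose-connection q q≢p)
      where
      q : Fin N
      q = g ⟨$⟩ˡ p
      τ : Perm N
      τ = transpose q p
      q≢p : q ≢ p
      q≢p q≡p = g∉C (from (cosetsIn⇔fixes g) (⟨$⟩ˡ-fixed (inv g) q≡p))
      gτp≡p : (g · τ) ⟨$⟩ʳ p ≡ p
      gτp≡p = trans (cong (g ⟨$⟩ʳ_) (transpose-matchʳ q p)) (inverseʳ g)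

    C-unique : ∀ g c c′ → ¬ C g → C c → C c′ → Adj H Connection g c → Adj H Connection g c′ →
               SameCoset H c c′
    C-unique g c c′ _ c∈C c′∈C u-conn u′-conn i Fi = begin
      c ⟨$⟩ˡ (c′ ⟨$⟩ʳ i)  ≡⟨ cong (c ⟨$⟩ˡ_) (sym ci≡c′i) ⟩
      c ⟨$⟩ˡ (c ⟨$⟩ʳ i)   ≡⟨ inverseˡ c ⟩
      i                   ∎
      where
      up≡u′p : g ⟨$⟩ˡ (c ⟨$⟩ʳ p) ≡ g ⟨$⟩ˡ (c′ ⟨$⟩ʳ p)
      up≡u′p = cong (g ⟨$⟩ˡ_) (trans (to (cosetsIn⇔fixes c) c∈C)
                                     (sym (to (cosetsIn⇔fixes c′) c′∈C)))
      ci≡c′i : c ⟨$⟩ʳ i ≡ c′ ⟨$⟩ʳ i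
      ci≡c′i = ⟨$⟩ʳ-injective (inv g)
        (Connection-determined-at-p (inv g · c) (inv g · c′) u-conn u′-conn up≡u′p i Fi)

    stabilizer-isPerfectCodeOfPair : IsPerfectCodeOfPair H A
    stabilizer-isPerfectCodeOfPair =
      (λ h hH → from (A⇔Fixes h) (hH p Fp)) ,
      Connection ,
      Connection-isConnectionSet ,
      record { independent = C-independent ; dominating = C-dominating ; unique = C-unique }

proposition5p6 : (n : ℕ) → 5 ≤ n → IsPerfectCodeOfPair {n} (Sym n 3) (Sym n (n ∸ 1))
proposition5p6 (suc m) (s≤s 4≤m) =
  StabilizerOfPoint.stabilizer-isPerfectCodeOfPair (λ i → 3 ≤? toℕ i) 3≤last
    (Sym (suc m) m) (Sym-last⇔Fixes m)
  where
  3≤last : 3 ≤ toℕ (fromℕ m)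
  3≤last = subst (3 ≤_) (sym (toℕ-fromℕ m)) (≤-trans (n≤1+n 3) 4≤m)
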